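{- For all natural numbers $n > m \geq 0$ and $0 \leq t \leq n$, \[ d^t_{n,m} = d^t_{n,m-1} + \sum_{k=1}^{n-m-1} d^{t-k}_{n-k,m-1} \binom{b_{m,m-1}}{k} + \binom{b_{m,m-1}}{n-m} \sum_{k=0}^m d^{t-n+m}_{k,k-1}, \] where $d^t_{0,-1} = 1$ and $d^t_{n,-1} = 0$ for all $n \geq 1$ and $t \geq 0$, and where $\binom{a}{b} = 0$ if $a < b$.
   Context: The adjunctive hierarchy of hereditarily finite sets is defined by $A_0 := \{\emptyset\}$ and $A_{n+1} := \{\emptyset\} \cup \{ x \cup \{y\} : x, y \in A_n\}$, with the convention $A_n := \emptyset$ for integers $n<0$. For integers $n,m$, $b_{n,m} := |\{ x \in A_n \setminus A_{n-1} : x \subseteq A_m\}|$. For integers $n, m, t$, let $D^t_{n,m} := \{ x \in A_n \setminus A_{n-1} : x \subseteq A_m \text{ and } |x| \leq t\}$ and $d^t_{n,m} := |D^t_{n,m}|$ (so $d^t_{n,m} = 0$ when $t < 0$). -}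

module Defs where

open import Data.Nat using (ℕ; zero; suc; _+_; _*_; _∸_; _^_; _≟_; _≤?_; _≤_)
open import Data.Nat.DivMod using (_/_; _%_)
open import Data.Integer using (ℤ; +_; -[1+_]) renaming (_≤?_ to _≤ℤ?_; _-_ to _-ℤ_)
open import Data.List using (List; []; _∷_; [_]; map; concatMap; filter; length; upTo; deduplicate)
open import Data.Nat.ListAction using (sum)
open import Data.List.Relation.Unary.All using (All; all?)
open import Data.List.Membership.DecPropositional _≟_ using (_∈?_; _∈_)
open import Data.Product using (_×_)
open import Relation.Nullary using (Dec; ¬?; does)
open import Relation.Nullary.Decidable using (_×-dec_)
open import Relation.Binary.PropositionalEquality using (_≡_)
open import Data.Bool using (if_then_else_)

-- Hereditarily finite sets are represented by their Ackermann codes: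
-- a natural number y codes the set {x : the x-th binary digit of y is 1}.
-- This is a bijection between ℕ and the hereditarily finite sets.

shiftR : ℕ → ℕ → ℕ
shiftR y zero = y
shiftR y (suc i) = shiftR (y / 2) i

_∈HF_ : ℕ → ℕ → Set
i ∈HF y = shiftR y i % 2 ≡ 1

_∈HF?_ : (i y : ℕ) → Dec (i ∈HF y)
i ∈HF? y = (shiftR y i % 2) ≟ 1

-- list of members of y (every member i satisfies i < y, since 2^i ≤ y)
members : ℕ → List ℕ
members y = filter (λ i → i ∈HF? y) (upTo y)

card : ℕ → ℕ
card y = length (members y)

adjoin : ℕ → ℕ → ℕ
adjoin x y = if does (y ∈HF? x) then x else x + 2 ^ y

Aℕ : ℕ → List ℕ
Aℕ zero = [ 0 ]
Aℕ (suc n) = deduplicate _≟_ (0 ∷ concatMap (λ x → map (λ y → adjoin x y) (Aℕ n)) (Aℕ n))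

A : ℤ → List ℕ
A (+ n) = Aℕ n
A -[1+ _ ] = []

_⊆A_ : ℕ → ℤ → Set
x ⊆A m = All (λ i → i ∈ A m) (members x)

_⊆A?_ : (x : ℕ) (m : ℤ) → Dec (x ⊆A m)
x ⊆A? m = all? (λ i → i ∈? A m) (members x)

B : ℤ → ℤ → List ℕ
B n m = filter (λ x → ¬? (x ∈? A (n -ℤ + 1)) ×-dec (x ⊆A? m)) (A n)

b : ℤ → ℤ → ℕ
b n m = length (B n m)

D : ℤ → ℤ → ℤ → List ℕ
D t n m = filter (λ x → (+ card x) ≤ℤ? t) (B n m)

d : ℤ → ℤ → ℤ → ℕ
d t n m = length (D t n m)

-- Σ_{k=a}^{c} f k  (empty if c < a)
sumFromTo : ℕ → ℕ → (ℕ → ℕ) → ℕ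
sumFromTo a c f = sum (map (λ i → f (a + i)) (upTo (suc c ∸ a)))

module Submission where

-- Call B_m := A_m ∖ A_{m-1} the sets
-- of exact level m.  Every x ⊆ A_m splits uniquely as x = S ∪ y with S ⊆ B_m
-- and y ⊆ A_{m-1}.  The key structural fact (insertAll-∈A⇔) is that for
-- S ≠ ∅ with k := |S|
--     S ∪ y ∈ A_n   ⟺   k + m ≤ n  and  y ∈ A_{n-k},
-- since each adjunction step of the hierarchy can add at most one element of
-- level m.  Hence the members x = S ∪ y of D^t_{n,m} fall into three classes:
--   k = 0          : x ∈ D^t_{n,m-1};
--   1 ≤ k < n - m  : S is any k-subset of B_m and y ∈ D^{t-k}_{n-k,m-1};
--   k = n - m      : S is any k-subset of B_m and y ∈ ⋃_{j ≤ m} D^{t-n+m}_{j,j-1}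
-- (the last union being disjoint because exact levels are unique).

open import Defs
open import Data.Nat using (ℕ; zero; suc; _+_; _*_; _∸_; _^_; _≤_; _<_; z≤n; s≤s; _≟_; _≤?_)
open import Data.Nat.Properties
open import Data.Nat.DivMod
open import Data.Nat.Divisibility using (divides-refl)
open import Data.Nat.Combinatorics using (_C_; nCk+nC[k+1]≡[n+1]C[k+1])
open import Data.Nat.ListAction using (sum)
open import Data.Integer using (ℤ; +_; -[1+_]; -_; +≤+) renaming (_-_ to _-ℤ_; _+_ to _+ℤ_; _≤_ to _≤ℤ_; _≤?_ to _≤ℤ?_)
import Data.Integer.Properties as ℤ
open import Data.Bool using (if_then_else_)
open import Data.Empty using (⊥; ⊥-elim)
open import Data.Product using (Σ; _×_; _,_; proj₁; proj₂)
open import Data.Sum using (_⊎_; inj₁; inj₂; [_,_]′)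
open import Data.List using (List; []; _∷_; map; concatMap; filter; length; upTo; _++_)
open import Data.List.Properties using (length-++; length-map; map-cong; filter-accept; filter-reject)
open import Data.List.Membership.Propositional using (_∈_; _∉_; find; lose)
open import Data.List.Membership.Propositional.Properties
import Data.List.Membership.DecPropositional _≟_ as DecMem
open import Data.List.Relation.Unary.Any using (here; there)
import Data.List.Relation.Unary.All as All
open import Data.List.Relation.Unary.Unique.Propositional using (Unique; []; _∷_)
open import Data.List.Relation.Unary.Unique.Propositional.Properties using (filter⁺; upTo⁺; ++⁺; Unique[x∷xs]⇒x∉xs)
open import Data.List.Relation.Unary.Unique.DecPropositional.Properties _≟_ using (deduplicate-!)
open import Data.List.Membership.Propositional.Properties.WithK using (unique∧set⇒bag)
open import Data.List.Relation.Binary.BagAndSetEquality using (∼bag⇒↭)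
open import Data.List.Relation.Binary.Permutation.Propositional.Properties using (↭-length)
open import Function.Bundles using (_⇔_; mk⇔; Equivalence)
open import Relation.Nullary using (¬_; yes; no; ¬?)
open import Relation.Nullary.Decidable using (dec-true; dec-false; _×-dec_)
open import Relation.Unary using (Decidable)
open import Relation.Binary.Definitions using (tri<; tri≈; tri>)
open import Relation.Binary.PropositionalEquality using (_≡_; _≢_; refl; sym; trans; cong; cong₂; subst; module ≡-Reasoning)
open import Function using (case_of_)

open Equivalence using (to; from)

count : ∀ {A : Set} {xs ys : List A} → Unique xs → Unique ys
      → (∀ x → x ∈ xs → x ∈ ys) → (∀ x → x ∈ ys → x ∈ xs) → length xs ≡ length ys
count ux uy f g = ↭-length (∼bag⇒↭ (unique∧set⇒bag ux uy (mk⇔ (f _) (g _))))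

module _ {A B : Set} where

  unique-map : (f : A → B) {xs : List A} → Unique xs
             → (∀ {a b} → a ∈ xs → b ∈ xs → f a ≡ f b → a ≡ b) → Unique (map f xs)
  unique-map f {[]} [] _ = []
  unique-map f {x ∷ xs} (x∉ ∷ u) inj =
    All.tabulate fresh ∷ unique-map f u (λ p q → inj (there p) (there q))
    where
    fresh : ∀ {v} → v ∈ map f xs → f x ≢ v
    fresh p fx≡v with ∈-map⁻ f p
    ... | a , a∈ , refl = All.lookup x∉ a∈ (inj (here refl) (there a∈) fx≡v)

  unique-concatMap : (f : A → List B) {xs : List A} → Unique xs → (∀ {a} → a ∈ xs → Unique (f a))
                   → (∀ {a a' y} → a ∈ xs → a' ∈ xs → y ∈ f a → y ∈ f a' → a ≡ a')
                   → Unique (concatMap f xs)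
  unique-concatMap f {[]} [] _ _ = []
  unique-concatMap f {x ∷ xs} (x∉ ∷ u) uf apart =
    ++⁺ (uf (here refl)) (unique-concatMap f u (λ p → uf (there p)) (λ p q → apart (there p) (there q)))
        (λ (p , q) → separate p q)
    where
    separate : ∀ {v} → v ∈ f x → v ∈ concatMap f xs → ⊥
    separate p q with find (∈-concatMap⁻ f q)
    ... | a , a∈ , v∈fa = All.lookup x∉ a∈ (apart (here refl) (there a∈) p v∈fa)

  length-concatMap : (f : A → List B) (xs : List A) → length (concatMap f xs) ≡ sum (map (λ a → length (f a)) xs)
  length-concatMap f [] = refl
  length-concatMap f (x ∷ xs) = trans (length-++ (f x)) (cong (λ r → length (f x) + r) (length-concatMap f xs))

  length-pairs : ∀ {C : Set} (g : A → B → C) (xs : List A) (ys : List B)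
               → length (concatMap (λ a → map (g a) ys) xs) ≡ length xs * length ys
  length-pairs g [] ys = refl
  length-pairs g (x ∷ xs) ys =
    trans (length-++ (map (g x) ys)) (cong₂ _+_ (length-map (g x) ys) (length-pairs g xs ys))

rm : ℕ → List ℕ → List ℕ
rm z = filter (λ i → ¬? (i ≟ z))

rm-⊆ : ∀ z S {i} → i ∈ rm z S → i ∈ S
rm-⊆ z S p = proj₁ (∈-filter⁻ (λ i → ¬? (i ≟ z)) {xs = S} p)

rm-≢ : ∀ z S {i} → i ∈ rm z S → i ≢ z
rm-≢ z S p = proj₂ (∈-filter⁻ (λ i → ¬? (i ≟ z)) {xs = S} p)

rm-! : ∀ z {S} → Unique S → Unique (rm z S)
rm-! z = filter⁺ (λ i → ¬? (i ≟ z))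

rm-∉ : ∀ {z} S → z ∉ S → rm z S ≡ S
rm-∉ [] _ = refl
rm-∉ {z} (a ∷ S) z∉ =
  trans (filter-accept (λ i → ¬? (i ≟ z)) (λ a≡z → z∉ (here (sym a≡z))))
        (cong (a ∷_) (rm-∉ S (λ p → z∉ (there p))))

rm-length : ∀ {z S} → Unique S → z ∈ S → length S ≡ suc (length (rm z S))
rm-length {z} {a ∷ S} (a∉S ∷ u) z∈ with a ≟ z
... | yes refl = cong (λ L → suc (length L))
                   (sym (trans (filter-reject (λ i → ¬? (i ≟ a)) {xs = S} (λ k → k refl))
                               (rm-∉ S (Unique[x∷xs]⇒x∉xs (a∉S ∷ u)))))
... | no a≢z with z∈
...   | here z≡a = ⊥-elim (a≢z (sym z≡a))
...   | there z∈S = trans (cong suc (rm-length u z∈S))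
                          (cong (λ L → suc (length L)) (sym (filter-accept (λ i → ¬? (i ≟ z)) {xs = S} a≢z)))

module _ {A : Set} where

  combs : ℕ → List A → List (List A)
  combs zero _ = [] ∷ []
  combs (suc k) [] = []
  combs (suc k) (b ∷ bs) = map (b ∷_) (combs k bs) ++ combs (suc k) bs

  combs-count : ∀ k bs → length (combs k bs) ≡ length bs C k
  combs-count zero bs = refl
  combs-count (suc k) [] = refl
  combs-count (suc k) (b ∷ bs) = begin
      length (map (b ∷_) (combs k bs) ++ combs (suc k) bs)
    ≡⟨ length-++ (map (b ∷_) (combs k bs)) ⟩
      length (map (b ∷_) (combs k bs)) + length (combs (suc k) bs)
    ≡⟨ cong₂ _+_ (trans (length-map (b ∷_) (combs k bs)) (combs-count k bs)) (combs-count (suc k) bs) ⟩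
      length bs C k + length bs C suc k
    ≡⟨ nCk+nC[k+1]≡[n+1]C[k+1] (length bs) k ⟩
      suc (length bs) C suc k
    ∎
    where open ≡-Reasoning

  combs-view : ∀ k b bs {S} → S ∈ combs k (b ∷ bs)
             → (Σ (List A) λ T → Σ ℕ λ j → S ≡ b ∷ T × T ∈ combs j bs) ⊎ (Σ ℕ λ j → S ∈ combs j bs)
  combs-view zero b bs (here refl) = inj₂ (0 , here refl)
  combs-view (suc k) b bs p with ∈-++⁻ (map (b ∷_) (combs k bs)) p
  ... | inj₂ q = inj₂ (suc k , q)
  ... | inj₁ q with ∈-map⁻ (b ∷_) q
  ...   | T , T∈ , refl = inj₁ (T , k , refl , T∈)

  combs-length : ∀ k bs {S} → S ∈ combs k bs → length S ≡ k
  combs-length zero bs (here refl) = refl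
  combs-length (suc k) (b ∷ bs) p with ∈-++⁻ (map (b ∷_) (combs k bs)) p
  ... | inj₂ q = combs-length (suc k) bs q
  ... | inj₁ q with ∈-map⁻ (b ∷_) q
  ...   | T , T∈ , refl = cong suc (combs-length k bs T∈)

  combs-⊆ : ∀ k bs {S i} → S ∈ combs k bs → i ∈ S → i ∈ bs
  combs-⊆ zero [] (here refl) ()
  combs-⊆ (suc k) [] () _
  combs-⊆ k (b ∷ bs) p i∈S with combs-view k b bs p
  ... | inj₂ (j , q) = there (combs-⊆ j bs q i∈S)
  ... | inj₁ (T , j , refl , T∈) with i∈S
  ...   | here i≡b = here i≡b
  ...   | there i∈T = there (combs-⊆ j bs T∈ i∈T)

  combs-elem-! : ∀ k bs {S} → Unique bs → S ∈ combs k bs → Unique S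
  combs-elem-! zero bs u (here refl) = []
  combs-elem-! (suc k) (b ∷ bs) (b∉ ∷ u) p with combs-view (suc k) b bs p
  ... | inj₂ (j , q) = combs-elem-! j bs u q
  ... | inj₁ (T , j , refl , T∈) =
    All.tabulate (λ i∈T b≡i → All.lookup b∉ (combs-⊆ j bs T∈ i∈T) b≡i) ∷ combs-elem-! j bs u T∈

  combs-ext : ∀ bs {k k' S S'} → Unique bs → S ∈ combs k bs → S' ∈ combs k' bs
            → (∀ i → i ∈ S → i ∈ S') → (∀ i → i ∈ S' → i ∈ S) → S ≡ S'
  combs-ext [] {zero} {zero} _ (here refl) (here refl) _ _ = refl
  combs-ext (b ∷ bs) {k} {k'} (b∉ ∷ u) p p' S⊆S' S'⊆S
    with combs-view k b bs p | combs-view k' b bs p'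
  ... | inj₁ (T , j , refl , T∈) | inj₁ (T' , j' , refl , T'∈) =
    cong (b ∷_) (combs-ext bs {j} {j'} u T∈ T'∈ (λ i q → tail T' (S⊆S' i (there q)) (b∉T j T∈ q))
                                                (λ i q → tail T (S'⊆S i (there q)) (b∉T j' T'∈ q)))
    where
    b∉T : ∀ j {T i} → T ∈ combs j bs → i ∈ T → b ≢ i
    b∉T j T∈ i∈T = All.lookup b∉ (combs-⊆ j bs T∈ i∈T)
    tail : ∀ T {i} → i ∈ b ∷ T → b ≢ i → i ∈ T
    tail T (here i≡b) b≢i = ⊥-elim (b≢i (sym i≡b))
    tail T (there q) _ = q
  ... | inj₁ (T , j , refl , T∈) | inj₂ (j' , q') =
    ⊥-elim (All.lookup b∉ (combs-⊆ j' bs q' (S⊆S' b (here refl))) refl)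
  ... | inj₂ (j , q) | inj₁ (T' , j' , refl , T'∈) =
    ⊥-elim (All.lookup b∉ (combs-⊆ j bs q (S'⊆S b (here refl))) refl)
  ... | inj₂ (j , q) | inj₂ (j' , q') = combs-ext bs {j} {j'} u q q' S⊆S' S'⊆S

  combs-! : ∀ k bs → Unique bs → Unique (combs k bs)
  combs-! zero bs _ = All.[] ∷ []
  combs-! (suc k) [] _ = []
  combs-! (suc k) (b ∷ bs) (b∉ ∷ u) =
    ++⁺ (unique-map (b ∷_) (combs-! k bs u) λ { _ _ refl → refl }) (combs-! (suc k) bs u)
        (λ (p , q) → omits-b p q)
    where
    omits-b : ∀ {S} → S ∈ map (b ∷_) (combs k bs) → S ∈ combs (suc k) bs → ⊥
    omits-b p q with ∈-map⁻ (b ∷_) p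
    ... | T , _ , refl = All.lookup b∉ (combs-⊆ (suc k) bs q (here refl)) refl

  combs-filter : ∀ {P : A → Set} (P? : Decidable P) bs → filter P? bs ∈ combs (length (filter P? bs)) bs
  combs-filter P? [] = here refl
  combs-filter P? (b ∷ bs) with P? b
  ... | yes _ = ∈-++⁺ˡ (∈-map⁺ (b ∷_) (combs-filter P? bs))
  ... | no _ with filter P? bs | combs-filter P? bs
  ...   | [] | q = here refl
  ...   | c ∷ cs | q = ∈-++⁺ʳ (map (b ∷_) (combs (length cs) bs)) q

parity : ∀ x → x % 2 ≡ 0 ⊎ x % 2 ≡ 1
parity x with x % 2 | m%n<n x 2
... | 0 | _ = inj₁ refl
... | 1 | _ = inj₂ refl
... | suc (suc _) | s≤s (s≤s ())

∉0 : ∀ i → ¬ (i ∈HF 0)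
∉0 i p = 0≢1+n (trans (sym (cong (_% 2) (shiftR-0 i))) p)
  where
  shiftR-0 : ∀ i → shiftR 0 i ≡ 0
  shiftR-0 zero = refl
  shiftR-0 (suc i) = shiftR-0 i

-- extensionality for codes below a bound N; the induction strips the last digit
ext-below : ∀ N x y → x ≤ N → y ≤ N
          → (∀ i → i ∈HF x → i ∈HF y) → (∀ i → i ∈HF y → i ∈HF x) → x ≡ y
ext-below zero zero zero _ _ _ _ = refl
ext-below (suc N) x y x≤ y≤ x⊆y y⊆x = begin
    x                    ≡⟨ m≡m%n+[m/n]*n x 2 ⟩
    x % 2 + (x / 2) * 2  ≡⟨ cong₂ (λ a c → a + c * 2) lastDigit higherDigits ⟩
    y % 2 + (y / 2) * 2  ≡⟨ sym (m≡m%n+[m/n]*n y 2) ⟩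
    y                    ∎
  where
  open ≡-Reasoning
  half≤ : ∀ z → z ≤ suc N → z / 2 ≤ N
  half≤ zero _ = z≤n
  half≤ (suc z) h = ≤-pred (≤-trans (m/n<m (suc z) 2 (s≤s (s≤s z≤n))) h)
  lastDigit : x % 2 ≡ y % 2
  lastDigit with parity x | parity y
  ... | inj₁ a | inj₁ c = trans a (sym c)
  ... | inj₂ a | inj₂ c = trans a (sym c)
  ... | inj₁ a | inj₂ c = ⊥-elim (0≢1+n (trans (sym a) (y⊆x 0 c)))
  ... | inj₂ a | inj₁ c = ⊥-elim (0≢1+n (trans (sym c) (x⊆y 0 a)))
  higherDigits : x / 2 ≡ y / 2
  higherDigits = ext-below N (x / 2) (y / 2) (half≤ x x≤) (half≤ y y≤)
                   (λ i → x⊆y (suc i)) (λ i → y⊆x (suc i))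

ext : ∀ {x y} → (∀ i → i ∈HF x → i ∈HF y) → (∀ i → i ∈HF y → i ∈HF x) → x ≡ y
ext {x} {y} = ext-below (x + y) x y (m≤m+n x y) (m≤n+m y x)

-- members of a code are smaller than it (since 2^i ≤ y)
∈HF⇒< : ∀ i y → i ∈HF y → i < y
∈HF⇒< zero zero ()
∈HF⇒< zero (suc y) p = s≤s z≤n
∈HF⇒< (suc i) zero p = ⊥-elim (∉0 (suc i) p)
∈HF⇒< (suc i) (suc y) p =
  <-≤-trans (s≤s (∈HF⇒< i (suc y / 2) p)) (m/n<m (suc y) 2 (s≤s (s≤s z≤n)))

addDigit-∈ : ∀ y x → ¬ (y ∈HF x) → ∀ i → i ∈HF (x + 2 ^ y) ⇔ (i ∈HF x ⊎ i ≡ y)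
addDigit-∈ zero x 0∉x zero = mk⇔ (λ _ → inj₂ refl) (λ _ → odd)
  where
  even : x % 2 ≡ 0
  even = [ (λ e → e) , (λ o → ⊥-elim (0∉x o)) ]′ (parity x)
  odd : (x + 1) % 2 ≡ 1
  odd = trans (%-distribˡ-+ x 1 2) (cong (λ r → (r + 1) % 2) even)
addDigit-∈ zero x 0∉x (suc i) =
  mk⇔ (λ p → inj₁ (subst (i ∈HF_) half p))
      (λ { (inj₁ p) → subst (i ∈HF_) (sym half) p ; (inj₂ ()) })
  where
  even : x % 2 ≡ 0
  even = [ (λ e → e) , (λ o → ⊥-elim (0∉x o)) ]′ (parity x)
  half : (x + 1) / 2 ≡ x / 2
  half = trans (+-distrib-/ x 1 (subst (λ r → r + 1 < 2) (sym even) (s≤s (s≤s z≤n))))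
               (+-identityʳ _)
addDigit-∈ (suc y) x _ zero =
  mk⇔ (λ p → inj₁ (trans (sym sameParity) p))
      (λ { (inj₁ p) → trans sameParity p ; (inj₂ ()) })
  where
  sameParity : (x + 2 ^ suc y) % 2 ≡ x % 2
  sameParity = trans (cong (λ z → (x + z) % 2) (*-comm 2 (2 ^ y))) ([m+kn]%n≡m%n x (2 ^ y) 2)
addDigit-∈ (suc y) x y∉x (suc i) =
  mk⇔ (λ p → shiftUp (to (addDigit-∈ y (x / 2) y∉x i) (subst (i ∈HF_) half p)))
      (λ q → subst (i ∈HF_) (sym half) (from (addDigit-∈ y (x / 2) y∉x i) (shiftDown q)))
  where
  half : (x + 2 ^ suc y) / 2 ≡ x / 2 + 2 ^ y
  half = trans (cong (λ z → (x + z) / 2) (*-comm 2 (2 ^ y)))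
               (trans (+-distrib-/-∣ʳ x (divides-refl (2 ^ y))) (cong (λ z → x / 2 + z) (m*n/n≡m (2 ^ y) 2)))
  shiftUp : i ∈HF (x / 2) ⊎ i ≡ y → suc i ∈HF x ⊎ suc i ≡ suc y
  shiftUp (inj₁ a) = inj₁ a
  shiftUp (inj₂ a) = inj₂ (cong suc a)
  shiftDown : suc i ∈HF x ⊎ suc i ≡ suc y → i ∈HF (x / 2) ⊎ i ≡ y
  shiftDown (inj₁ a) = inj₁ a
  shiftDown (inj₂ a) = inj₂ (suc-injective a)

adjoin-∈ : ∀ x y i → i ∈HF adjoin x y ⇔ (i ∈HF x ⊎ i ≡ y)
adjoin-∈ x y i with y ∈HF? x
... | yes y∈x = subst (λ a → i ∈HF a ⇔ (i ∈HF x ⊎ i ≡ y)) (sym present)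
                      (mk⇔ inj₁ λ { (inj₁ q) → q ; (inj₂ refl) → y∈x })
  where
  present : adjoin x y ≡ x
  present = cong (λ c → if c then x else x + 2 ^ y) (dec-true (y ∈HF? x) y∈x)
... | no y∉x = subst (λ a → i ∈HF a ⇔ (i ∈HF x ⊎ i ≡ y)) (sym absent) (addDigit-∈ y x y∉x i)
  where
  absent : adjoin x y ≡ x + 2 ^ y
  absent = cong (λ c → if c then x else x + 2 ^ y) (dec-false (y ∈HF? x) y∉x)

∈adjoin-≢ : ∀ x z i → i ∈HF adjoin x z → i ≢ z → i ∈HF x
∈adjoin-≢ x z i p i≢z = [ (λ q → q) , (λ e → ⊥-elim (i≢z e)) ]′ (to (adjoin-∈ x z i) p)

members-∈ : ∀ y i → i ∈ members y ⇔ i ∈HF y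
members-∈ y i = mk⇔ (λ p → proj₂ (∈-filter⁻ (_∈HF? y) {xs = upTo y} p))
                    (λ p → ∈-filter⁺ (_∈HF? y) (∈-upTo⁺ (∈HF⇒< i y p)) p)

members-! : ∀ y → Unique (members y)
members-! y = filter⁺ (_∈HF? y) (upTo⁺ y)

card-of : ∀ x (L : List ℕ) → Unique L
        → (∀ i → i ∈ L → i ∈HF x) → (∀ i → i ∈HF x → i ∈ L) → card x ≡ length L
card-of x L u f g = count (members-! x) u (λ i p → g i (to (members-∈ x i) p))
                                          (λ i p → from (members-∈ x i) (f i p))

insertAll : List ℕ → ℕ → ℕ
insertAll [] y = y
insertAll (s ∷ S) y = adjoin (insertAll S y) s

insertAll-∈ : ∀ S y i → i ∈HF insertAll S y ⇔ (i ∈ S ⊎ i ∈HF y)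
insertAll-∈ [] y i = mk⇔ inj₂ λ { (inj₁ ()) ; (inj₂ p) → p }
insertAll-∈ (s ∷ S) y i = mk⇔ split merge
  where
  split : i ∈HF insertAll (s ∷ S) y → i ∈ s ∷ S ⊎ i ∈HF y
  split p with to (adjoin-∈ (insertAll S y) s i) p
  ... | inj₂ i≡s = inj₁ (here i≡s)
  ... | inj₁ q with to (insertAll-∈ S y i) q
  ...   | inj₁ i∈S = inj₁ (there i∈S)
  ...   | inj₂ i∈y = inj₂ i∈y
  merge : i ∈ s ∷ S ⊎ i ∈HF y → i ∈HF insertAll (s ∷ S) y
  merge (inj₁ (here i≡s)) = from (adjoin-∈ (insertAll S y) s i) (inj₂ i≡s)
  merge (inj₁ (there i∈S)) = from (adjoin-∈ (insertAll S y) s i) (inj₁ (from (insertAll-∈ S y i) (inj₁ i∈S)))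
  merge (inj₂ i∈y) = from (adjoin-∈ (insertAll S y) s i) (inj₁ (from (insertAll-∈ S y i) (inj₂ i∈y)))

sep : {P : ℕ → Set} → Decidable P → ℕ → ℕ
sep P? x = insertAll (filter P? (members x)) 0

sep-∈ : ∀ {P : ℕ → Set} (P? : Decidable P) x i → i ∈HF sep P? x ⇔ (i ∈HF x × P i)
sep-∈ {P} P? x i = mk⇔ out into
  where
  out : i ∈HF sep P? x → i ∈HF x × P i
  out p with to (insertAll-∈ (filter P? (members x)) 0 i) p
  ... | inj₂ i∈0 = ⊥-elim (∉0 i i∈0)
  ... | inj₁ i∈L = let (m , Pi) = ∈-filter⁻ P? {xs = members x} i∈L in to (members-∈ x i) m , Pi
  into : i ∈HF x × P i → i ∈HF sep P? x
  into (i∈x , Pi) = from (insertAll-∈ (filter P? (members x)) 0 i)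
                         (inj₁ (∈-filter⁺ P? (from (members-∈ x i) i∈x) Pi))

remove : ℕ → ℕ → ℕ
remove x z = sep (λ i → ¬? (i ≟ z)) x

remove-∈ : ∀ x z i → i ∈HF remove x z ⇔ (i ∈HF x × i ≢ z)
remove-∈ x z = sep-∈ (λ i → ¬? (i ≟ z)) x

empty≡0 : ∀ {x} → (∀ i → ¬ i ∈HF x) → x ≡ 0
empty≡0 x-empty = ext (λ i p → ⊥-elim (x-empty i p)) (λ i p → ⊥-elim (∉0 i p))

adjoin-remove : ∀ {x z} → z ∈HF x → adjoin (remove x z) z ≡ x
adjoin-remove {x} {z} z∈x = ext into out
  where
  into : ∀ i → i ∈HF adjoin (remove x z) z → i ∈HF x
  into i p with to (adjoin-∈ (remove x z) z i) p
  ... | inj₁ q = proj₁ (to (remove-∈ x z i) q)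
  ... | inj₂ refl = z∈x
  out : ∀ i → i ∈HF x → i ∈HF adjoin (remove x z) z
  out i p with i ≟ z
  ... | yes i≡z = from (adjoin-∈ (remove x z) z i) (inj₂ i≡z)
  ... | no i≢z = from (adjoin-∈ (remove x z) z i) (inj₁ (from (remove-∈ x z i) (p , i≢z)))

A-suc⁻ : ∀ n x → x ∈ Aℕ (suc n)
       → x ≡ 0 ⊎ Σ ℕ λ w → Σ ℕ λ z → w ∈ Aℕ n × z ∈ Aℕ n × x ≡ adjoin w z
A-suc⁻ n x p with ∈-deduplicate⁻ _≟_ (0 ∷ concatMap (λ w → map (adjoin w) (Aℕ n)) (Aℕ n)) p
... | here x≡0 = inj₁ x≡0
... | there q with find (∈-concatMap⁻ (λ w → map (adjoin w) (Aℕ n)) q)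
...   | w , w∈ , r with ∈-map⁻ (adjoin w) r
...     | z , z∈ , refl = inj₂ (w , z , w∈ , z∈ , refl)

0∈A : ∀ n → 0 ∈ Aℕ n
0∈A zero = here refl
0∈A (suc n) = ∈-deduplicate⁺ _≟_ {xs = 0 ∷ concatMap (λ w → map (adjoin w) (Aℕ n)) (Aℕ n)} (here refl)

adjoin∈A : ∀ n {w z} → w ∈ Aℕ n → z ∈ Aℕ n → adjoin w z ∈ Aℕ (suc n)
adjoin∈A n {w} {z} w∈ z∈ =
  ∈-deduplicate⁺ _≟_ (there (∈-concatMap⁺ (λ w → map (adjoin w) (Aℕ n)) (lose w∈ (∈-map⁺ (adjoin w) z∈))))

A0⇒≡0 : ∀ {x} → x ∈ Aℕ 0 → x ≡ 0
A0⇒≡0 (here x≡0) = x≡0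

A-mono-suc : ∀ n {x} → x ∈ Aℕ n → x ∈ Aℕ (suc n)
A-mono-suc zero p rewrite A0⇒≡0 p = 0∈A 1
A-mono-suc (suc n) {x} p with A-suc⁻ n x p
... | inj₁ refl = 0∈A (suc (suc n))
... | inj₂ (w , z , w∈ , z∈ , refl) = adjoin∈A (suc n) (A-mono-suc n w∈) (A-mono-suc n z∈)

A-mono : ∀ {n n' x} → n ≤ n' → x ∈ Aℕ n → x ∈ Aℕ n'
A-mono {n} {n'} {x} n≤n' p with m≤n⇒∃[o]m+o≡n n≤n'
... | o , refl = lift o
  where
  lift : ∀ o → x ∈ Aℕ (n + o)
  lift zero rewrite +-identityʳ n = p
  lift (suc o) rewrite +-suc n o = A-mono-suc (n + o) (lift o)

ALt : ℕ → List ℕ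
ALt zero = []
ALt (suc m) = Aℕ m

ALt≡ : ∀ m → A (+ m -ℤ + 1) ≡ ALt m
ALt≡ zero = refl
ALt≡ (suc m) = refl

ALt⊆A : ∀ m {x} → x ∈ ALt m → x ∈ Aℕ m
ALt⊆A (suc m) p = A-mono-suc m p

ALt-mono : ∀ {m m' x} → m ≤ m' → x ∈ ALt m → x ∈ ALt m'
ALt-mono {suc m} {suc m'} (s≤s m≤m') p = A-mono m≤m' p

A⊆ALt : ∀ {m m' x} → m < m' → x ∈ Aℕ m → x ∈ ALt m'
A⊆ALt {m' = suc m'} (s≤s m≤m') p = A-mono m≤m' p

A-elem : ∀ n {x i} → x ∈ Aℕ n → i ∈HF x → i ∈ ALt n
A-elem zero {i = i} p q = ⊥-elim (∉0 i (subst (i ∈HF_) (A0⇒≡0 p) q))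
A-elem (suc n) {x} {i} p q with A-suc⁻ n x p
... | inj₁ refl = ⊥-elim (∉0 i q)
... | inj₂ (w , z , w∈ , z∈ , refl) with to (adjoin-∈ w z i) q
...   | inj₂ refl = z∈
...   | inj₁ i∈w = ALt⊆A n (A-elem n w∈ i∈w)

A-dc : ∀ n {x x'} → x ∈ Aℕ n → (∀ i → i ∈HF x' → i ∈HF x) → x' ∈ Aℕ n
A-dc zero {x} {x'} p x'⊆x =
  subst (_∈ Aℕ 0) (sym (empty≡0 λ i q → ∉0 i (subst (i ∈HF_) (A0⇒≡0 p) (x'⊆x i q)))) (here refl)
A-dc (suc n) {x} {x'} p x'⊆x with A-suc⁻ n x p
... | inj₁ refl = subst (_∈ Aℕ (suc n)) (sym (empty≡0 λ i q → ∉0 i (x'⊆x i q))) (0∈A (suc n))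
... | inj₂ (w , z , w∈ , z∈ , refl) with z ∈HF? x'
...   | no z∉x' = A-mono-suc n (A-dc n w∈ λ i q → ∈adjoin-≢ w z i (x'⊆x i q) λ { refl → z∉x' q })
...   | yes z∈x' = subst (_∈ Aℕ (suc n)) (adjoin-remove z∈x') (adjoin∈A n (A-dc n w∈ rest⊆w) z∈)
  where
  rest⊆w : ∀ i → i ∈HF remove x' z → i ∈HF w
  rest⊆w i q = let (i∈x' , i≢z) = to (remove-∈ x' z i) q in ∈adjoin-≢ w z i (x'⊆x i i∈x') i≢z

Aℕ-! : ∀ n → Unique (Aℕ n)
Aℕ-! zero = All.[] ∷ []
Aℕ-! (suc n) = deduplicate-! (0 ∷ concatMap (λ w → map (adjoin w) (Aℕ n)) (Aℕ n))

Fresh : ℕ → ℕ → Set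
Fresh m x = x ∈ Aℕ m × x ∉ ALt m

Small : ℕ → ℕ → Set
Small m y = ∀ i → i ∈HF y → i ∈ ALt m

fresh-le : ∀ {m n z} → z ∈ Aℕ n → Fresh m z → m ≤ n
fresh-le {m} {n} z∈ (_ , z∉) with m ≤? n
... | yes m≤n = m≤n
... | no m≰n = ⊥-elim (z∉ (A⊆ALt (≰⇒> m≰n) z∈))

level : ∀ m {y} → y ∈ Aℕ m → Σ ℕ λ j → j ≤ m × Fresh j y
level zero p = 0 , z≤n , p , λ ()
level (suc m) {y} p with y DecMem.∈? Aℕ m
... | yes q = let (j , j≤m , fr) = level m q in j , m≤n⇒m≤1+n j≤m , fr
... | no q = suc m , ≤-refl , p , q

level-unique : ∀ {j j' y} → Fresh j y → Fresh j' y → j ≡ j'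
level-unique {j} {j'} (y∈ , y∉) (y∈' , y∉') with <-cmp j j'
... | tri< j<j' _ _ = ⊥-elim (y∉' (A⊆ALt j<j' y∈))
... | tri≈ _ j≡j' _ = j≡j'
... | tri> _ _ j>j' = ⊥-elim (y∉ (A⊆ALt j>j' y∈'))

small-lift : ∀ {m k n z} → z ∈ ALt m → k + m ≤ n → z ∈ Aℕ (n ∸ k)
small-lift {m} {k} {n} p k+m≤n =
  ALt⊆A (n ∸ k) (ALt-mono (m+n≤o⇒m≤o∸n m (subst (_≤ n) (+-comm k m) k+m≤n)) p)

-- S ∪ y ∈ A_n whenever S ⊆ A_m, |S| + m ≤ n and y ∈ A_{n-|S|}:
-- the entries of S are adjoined one level at a time
insertAll-∈A : ∀ {m} n S {y} → (∀ s → s ∈ S → s ∈ Aℕ m)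
             → length S + m ≤ n → y ∈ Aℕ (n ∸ length S) → insertAll S y ∈ Aℕ n
insertAll-∈A n [] _ _ y∈ = y∈
insertAll-∈A (suc n) (s ∷ S) S⊆A (s≤s le) y∈ =
  adjoin∈A n (insertAll-∈A n S (λ t p → S⊆A t (there p)) le y∈)
             (A-mono (m+n≤o⇒n≤o (length S) le) (S⊆A s (here refl)))

-- conversely, a set in A_n containing k ≥ 1 distinct elements of exact
-- level m has k + m ≤ n: each adjunction step contributes at most one of them
fresh-count-bound : ∀ {m} n {x} S → Unique S → S ≢ [] → (∀ s → s ∈ S → Fresh m s)
                  → (∀ s → s ∈ S → s ∈HF x) → x ∈ Aℕ n → length S + m ≤ n
fresh-count-bound n [] _ S≢[] _ _ _ = ⊥-elim (S≢[] refl)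
fresh-count-bound zero (s ∷ S) _ _ _ S⊆x x∈ with A-elem zero {i = s} x∈ (S⊆x s (here refl))
... | ()
fresh-count-bound {m} (suc n) {x} S@(s₀ ∷ _) u _ fresh S⊆x x∈ with A-suc⁻ n x x∈
... | inj₁ refl = ⊥-elim (∉0 s₀ (S⊆x s₀ (here refl)))
... | inj₂ (w , z , w∈ , z∈ , refl) with z DecMem.∈? S
...   | no z∉S = m≤n⇒m≤1+n (fresh-count-bound {m} n S u (λ ()) fresh S⊆w w∈)
  where
  S⊆w : ∀ s → s ∈ S → s ∈HF w
  S⊆w s p = ∈adjoin-≢ w z s (S⊆x s p) λ { refl → z∉S p }
...   | yes z∈S = subst (λ k → k + m ≤ suc n) (sym (rm-length u z∈S)) (s≤s (rest (rm z S) refl))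
  where
  rest : ∀ S' → S' ≡ rm z S → length S' + m ≤ n
  rest [] _ = fresh-le {m} z∈ (fresh z z∈S)
  rest (_ ∷ _) eq = subst (λ L → length L + m ≤ n) (sym eq)
    (fresh-count-bound {m} n (rm z S) (rm-! z u) (λ e → case trans eq e of λ ())
       (λ s p → fresh s (rm-⊆ z S p)) (λ s p → ∈adjoin-≢ w z s (S⊆x s (rm-⊆ z S p)) (rm-≢ z S p)) w∈)

lower-part-level : ∀ {m} n {x} S {y} → Unique S → (∀ s → s ∈ S → Fresh m s) → Small m y
           → (∀ s → s ∈ S → s ∈HF x) → (∀ i → i ∈HF y → i ∈HF x) → x ∈ Aℕ n
           → y ∈ Aℕ (n ∸ length S)
lower-part-level n [] _ _ _ _ y⊆x x∈ = A-dc n x∈ y⊆x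
lower-part-level zero (s ∷ S) _ _ _ S⊆x _ x∈ with A-elem zero {i = s} x∈ (S⊆x s (here refl))
... | ()
lower-part-level {m} (suc n) {x} S@(s₀ ∷ _) {y} u fresh small S⊆x y⊆x x∈ with A-suc⁻ n x x∈
... | inj₁ refl = ⊥-elim (∉0 s₀ (S⊆x s₀ (here refl)))
... | inj₂ (w , z , w∈ , z∈ , refl) with z DecMem.∈? S | z ∈HF? y
...   | yes z∈S | _ =
  subst (λ k → y ∈ Aℕ (suc n ∸ k)) (sym (rm-length u z∈S))
    (lower-part-level {m} n (rm z S) (rm-! z u) (λ s p → fresh s (rm-⊆ z S p)) small
       (λ s p → ∈adjoin-≢ w z s (S⊆x s (rm-⊆ z S p)) (rm-≢ z S p))
       (λ i p → ∈adjoin-≢ w z i (y⊆x i p) λ { refl → proj₂ (fresh z z∈S) (small z p) }) w∈)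
...   | no z∉S | no z∉y =
  A-mono (∸-monoˡ-≤ (length S) (n≤1+n n))
    (lower-part-level {m} n S u fresh small (λ s p → ∈adjoin-≢ w z s (S⊆x s p) λ { refl → z∉S p })
       (λ i p → ∈adjoin-≢ w z i (y⊆x i p) λ { refl → z∉y p }) w∈)
...   | no z∉S | yes z∈y =
  subst (_∈ Aℕ (suc n ∸ length S)) (adjoin-remove z∈y)
    (subst (λ l → adjoin (remove y z) z ∈ Aℕ l) (sym (+-∸-assoc 1 (m+n≤o⇒m≤o (length S) bound)))
       (adjoin∈A (n ∸ length S) rest∈ (small-lift {m} (small z z∈y) bound)))
  where
  S⊆w : ∀ s → s ∈ S → s ∈HF w
  S⊆w s p = ∈adjoin-≢ w z s (S⊆x s p) λ { refl → z∉S p }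
  bound : length S + m ≤ n
  bound = fresh-count-bound {m} n S u (λ ()) fresh S⊆w w∈
  rest∈ : remove y z ∈ Aℕ (n ∸ length S)
  rest∈ = lower-part-level {m} n S u fresh (λ i p → small i (proj₁ (to (remove-∈ y z i) p))) S⊆w
            (λ i p → let (i∈y , i≢z) = to (remove-∈ y z i) p in ∈adjoin-≢ w z i (y⊆x i i∈y) i≢z) w∈

insertAll-∈A⇔ : ∀ {m} n S y → Unique S → S ≢ [] → (∀ s → s ∈ S → Fresh m s) → Small m y
              → insertAll S y ∈ Aℕ n ⇔ (length S + m ≤ n × y ∈ Aℕ (n ∸ length S))
insertAll-∈A⇔ {m} n S y u S≢[] fresh small = mk⇔
  (λ x∈ → fresh-count-bound {m} n S u S≢[] fresh S⊆x x∈ , lower-part-level {m} n S u fresh small S⊆x y⊆x x∈)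
  (λ (le , y∈) → insertAll-∈A {m} n S (λ s p → proj₁ (fresh s p)) le y∈)
  where
  S⊆x : ∀ s → s ∈ S → s ∈HF insertAll S y
  S⊆x s p = from (insertAll-∈ S y s) (inj₁ p)
  y⊆x : ∀ i → i ∈HF y → i ∈HF insertAll S y
  y⊆x i p = from (insertAll-∈ S y i) (inj₂ p)

sub-nonneg : ∀ a c → c ≤ a → + a -ℤ + c ≡ + (a ∸ c)
sub-nonneg a c c≤a = trans (ℤ.m-n≡m⊖n a c) (ℤ.⊖-≥ c≤a)

sub-neg : ∀ a c → a < c → Σ ℕ λ r → + a -ℤ + c ≡ -[1+ r ]
sub-neg a c a<c with m≤n⇒∃[o]m+o≡n a<c
... | r , refl = r , trans (ℤ.m-n≡m⊖n a (suc a + r)) (trans (ℤ.⊖-< a<c) (cong (λ z → - (+ z)) a+r∸a))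
  where
  a+r∸a : suc a + r ∸ a ≡ suc r
  a+r∸a = trans (+-∸-assoc 1 (m≤m+n a r)) (cong suc (m+n∸m≡n a r))

≤-sub⇔ : ∀ p t k → (+ p ≤ℤ + t -ℤ + k) ⇔ (p + k ≤ t)
≤-sub⇔ p t k with k ≤? t
... | yes k≤t rewrite sub-nonneg t k k≤t =
  mk⇔ (λ q → m≤o∸n⇒m+n≤o p k≤t (ℤ.drop‿+≤+ q)) (λ q → +≤+ (m+n≤o⇒m≤o∸n p q))
... | no k≰t with sub-neg t k (≰⇒> k≰t)
...   | r , eq rewrite eq = mk⇔ (λ ()) (λ q → ⊥-elim (k≰t (m+n≤o⇒n≤o p q)))

last-bound≡ : ∀ t n m → m ≤ n → (+ t -ℤ + n) +ℤ + m ≡ + t -ℤ + (n ∸ m)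
last-bound≡ t n m m≤n = begin
    (+ t +ℤ - + n) +ℤ + m  ≡⟨ ℤ.+-assoc (+ t) (- + n) (+ m) ⟩
    + t +ℤ (- + n +ℤ + m)  ≡⟨ cong (+ t +ℤ_) (trans (ℤ.+-comm (- + n) (+ m)) (trans (ℤ.m-n≡m⊖n m n) (ℤ.⊖-≤ m≤n))) ⟩
    + t +ℤ - + (n ∸ m)     ∎
  where open ≡-Reasoning

<∸⇔ : ∀ k {m n} → m ≤ n → k < n ∸ m ⇔ k + m < n
<∸⇔ k m≤n = mk⇔ (m≤o∸n⇒m+n≤o (suc k) m≤n) (m+n≤o⇒m≤o∸n (suc k))

record InD (T : ℤ) (a b x : ℕ) : Set where
  constructor mkInD
  field
    fresh : Fresh a x
    small : Small b x
    size : + card x ≤ℤ T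
open InD

⊆A⇔ : ∀ x z → x ⊆A z ⇔ (∀ i → i ∈HF x → i ∈ A z)
⊆A⇔ x z = mk⇔ (λ p i q → All.lookup p (from (members-∈ x i) q))
              (λ f → All.tabulate λ {i} q → f i (to (members-∈ x i) q))

B-mem : ∀ a b x → x ∈ B (+ a) (+ b -ℤ + 1) ⇔ (Fresh a x × Small b x)
B-mem a b x = mk⇔ out into
  where
  P? : Decidable (λ x → x ∉ A (+ a -ℤ + 1) × x ⊆A (+ b -ℤ + 1))
  P? x = ¬? (x DecMem.∈? A (+ a -ℤ + 1)) ×-dec (x ⊆A? (+ b -ℤ + 1))
  out : x ∈ B (+ a) (+ b -ℤ + 1) → Fresh a x × Small b x
  out p = let (x∈ , x∉ , x⊆) = ∈-filter⁻ P? {xs = Aℕ a} p in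
          (x∈ , subst (x ∉_) (ALt≡ a) x∉) , (λ i q → subst (i ∈_) (ALt≡ b) (to (⊆A⇔ x (+ b -ℤ + 1)) x⊆ i q))
  into : Fresh a x × Small b x → x ∈ B (+ a) (+ b -ℤ + 1)
  into ((x∈ , x∉) , x⊆) = ∈-filter⁺ P? x∈
    (subst (x ∉_) (sym (ALt≡ a)) x∉ , from (⊆A⇔ x (+ b -ℤ + 1)) (λ i q → subst (i ∈_) (sym (ALt≡ b)) (x⊆ i q)))

D-mem : ∀ T a b x → x ∈ D T (+ a) (+ b -ℤ + 1) ⇔ InD T a b x
D-mem T a b x = mk⇔
  (λ p → let (x∈B , sz) = ∈-filter⁻ size? {xs = B (+ a) (+ b -ℤ + 1)} p
             (fr , sm) = to (B-mem a b x) x∈B in mkInD fr sm sz)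
  (λ d → ∈-filter⁺ size? (from (B-mem a b x) (fresh d , small d)) (size d))
  where
  size? : Decidable (λ x → + card x ≤ℤ T)
  size? x = (+ card x) ≤ℤ? T

A-! : ∀ z → Unique (A z)
A-! (+ n) = Aℕ-! n
A-! -[1+ n ] = []

D-! : ∀ T n m → Unique (D T n m)
D-! T n m = filter⁺ _ (filter⁺ _ (A-! n))

D-small : ∀ T z m {y} → y ∈ D T z (+ m -ℤ + 1) → Small m y
D-small T z m {y} p i q =
  subst (i ∈_) (ALt≡ m) (to (⊆A⇔ y (+ m -ℤ + 1)) (proj₂ (proj₂ (∈-filter⁻ _ {xs = A z} (proj₁ (∈-filter⁻ _ {xs = B z (+ m -ℤ + 1)} p))))) i q)

module Split (m : ℕ) where

  Bm : List ℕ
  Bm = B (+ m) (+ m -ℤ + 1)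

  -- B_m consists of the elements of exact level m (their members lie in A_{m-1} automatically)
  Bm-mem : ∀ s → s ∈ Bm ⇔ Fresh m s
  Bm-mem s = mk⇔ (λ p → proj₁ (to (B-mem m m s) p))
                 (λ fr → from (B-mem m m s) (fr , λ i q → A-elem m (proj₁ fr) q))

  Bm-! : Unique Bm
  Bm-! = filter⁺ _ (Aℕ-! m)

  chosen-fresh : ∀ k {S} → S ∈ combs k Bm → ∀ s → s ∈ S → Fresh m s
  chosen-fresh k S∈ s p = to (Bm-mem s) (combs-⊆ k Bm S∈ p)

  chosen-! : ∀ k {S} → S ∈ combs k Bm → Unique S
  chosen-! k = combs-elem-! k Bm Bm-!

  insertAll-fresh⁻ : ∀ S {y i} → Small m y → Fresh m i → i ∈HF insertAll S y → i ∈ S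
  insertAll-fresh⁻ S {y} {i} y-small (_ , i∉) p =
    [ (λ q → q) , (λ q → ⊥-elim (i∉ (y-small i q))) ]′ (to (insertAll-∈ S y i) p)

  insertAll-small⁻ : ∀ S {y i} → (∀ s → s ∈ S → Fresh m s) → i ∈ ALt m → i ∈HF insertAll S y → i ∈HF y
  insertAll-small⁻ S {y} {i} S-fresh i∈ p =
    [ (λ q → ⊥-elim (proj₂ (S-fresh i q) i∈)) , (λ q → q) ]′ (to (insertAll-∈ S y i) p)

  insertAll-injective : ∀ k k' {S S' y y'} → S ∈ combs k Bm → S' ∈ combs k' Bm → Small m y → Small m y'
                      → insertAll S y ≡ insertAll S' y' → S ≡ S' × y ≡ y'
  insertAll-injective k k' {S} {S'} {y} {y'} S∈ S'∈ y-small y'-small eq =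
      combs-ext Bm {k} {k'} Bm-! S∈ S'∈ (same-fresh k S S' y' y'-small S∈ eq) (same-fresh k' S' S y y-small S'∈ (sym eq))
    , ext (same-small k' S y S' y' S'∈ y-small eq) (same-small k S' y' S y S∈ y'-small (sym eq))
    where
    same-fresh : ∀ j T T' z' → Small m z' → T ∈ combs j Bm → ∀ {z} → insertAll T z ≡ insertAll T' z'
               → ∀ i → i ∈ T → i ∈ T'
    same-fresh j T T' z' z'-small T∈ {z} e i p =
      insertAll-fresh⁻ T' z'-small (chosen-fresh j T∈ i p) (subst (i ∈HF_) e (from (insertAll-∈ T z i) (inj₁ p)))
    same-small : ∀ j T z T' z' → T' ∈ combs j Bm → Small m z → insertAll T z ≡ insertAll T' z'
                → ∀ i → i ∈HF z → i ∈HF z'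
    same-small j T z T' z' T'∈ z-small e i p =
      insertAll-small⁻ T' (chosen-fresh j T'∈) (z-small i p) (subst (i ∈HF_) e (from (insertAll-∈ T z i) (inj₂ p)))

  freshPart : ℕ → List ℕ
  freshPart x = filter (_∈HF? x) Bm

  κ : ℕ → ℕ
  κ x = length (freshPart x)

  smallPart : ℕ → ℕ
  smallPart x = sep (DecMem._∈? ALt m) x

  split : ∀ x → Small (suc m) x → x ≡ insertAll (freshPart x) (smallPart x)
  split x x⊆ = ext into out
    where
    into : ∀ i → i ∈HF x → i ∈HF insertAll (freshPart x) (smallPart x)
    into i p with i DecMem.∈? ALt m
    ... | yes i∈ = from (insertAll-∈ (freshPart x) (smallPart x) i)
                        (inj₂ (from (sep-∈ (DecMem._∈? ALt m) x i) (p , i∈)))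
    ... | no i∉ = from (insertAll-∈ (freshPart x) (smallPart x) i)
                       (inj₁ (∈-filter⁺ (_∈HF? x) (from (Bm-mem i) (x⊆ i p , i∉)) p))
    out : ∀ i → i ∈HF insertAll (freshPart x) (smallPart x) → i ∈HF x
    out i p with to (insertAll-∈ (freshPart x) (smallPart x) i) p
    ... | inj₁ q = proj₂ (∈-filter⁻ (_∈HF? x) {xs = Bm} q)
    ... | inj₂ q = proj₁ (to (sep-∈ (DecMem._∈? ALt m) x i) q)

  smallPart-small : ∀ x → Small m (smallPart x)
  smallPart-small x i p = proj₂ (to (sep-∈ (DecMem._∈? ALt m) x i) p)

  freshPart-chosen : ∀ x → freshPart x ∈ combs (κ x) Bm
  freshPart-chosen x = combs-filter (_∈HF? x) Bm

  κ-insertAll : ∀ {k S y} → S ∈ combs k Bm → Small m y → κ (insertAll S y) ≡ k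
  κ-insertAll {k} {S} {y} S∈ y-small =
    trans (count (filter⁺ (_∈HF? x) Bm-!) (chosen-! k S∈)
                 (λ i p → insertAll-fresh⁻ S y-small (to (Bm-mem i) (proj₁ (∈-filter⁻ (_∈HF? x) {xs = Bm} p)))
                                            (proj₂ (∈-filter⁻ (_∈HF? x) {xs = Bm} p)))
                 (λ i p → ∈-filter⁺ (_∈HF? x) (combs-⊆ k Bm S∈ p) (from (insertAll-∈ S y i) (inj₁ p))))
          (combs-length k Bm S∈)
    where
    x = insertAll S y

  card-insertAll : ∀ {k S y} → S ∈ combs k Bm → Small m y → card (insertAll S y) ≡ k + card y
  card-insertAll {k} {S} {y} S∈ y-small = begin
      card (insertAll S y)       ≡⟨ card-of (insertAll S y) (S ++ members y) S++y-! into out ⟩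
      length (S ++ members y)    ≡⟨ length-++ S ⟩
      length S + card y          ≡⟨ cong (_+ card y) (combs-length k Bm S∈) ⟩
      k + card y                 ∎
    where
    open ≡-Reasoning
    S++y-! : Unique (S ++ members y)
    S++y-! = ++⁺ (chosen-! k S∈) (members-! y)
      (λ (p , q) → proj₂ (chosen-fresh k S∈ _ p) (y-small _ (to (members-∈ y _) q)))
    into : ∀ i → i ∈ S ++ members y → i ∈HF insertAll S y
    into i p = from (insertAll-∈ S y i) ([ inj₁ , (λ q → inj₂ (to (members-∈ y i) q)) ]′ (∈-++⁻ S p))
    out : ∀ i → i ∈HF insertAll S y → i ∈ S ++ members y
    out i p = [ ∈-++⁺ˡ , (λ q → ∈-++⁺ʳ S (from (members-∈ y i) q)) ]′ (to (insertAll-∈ S y i) p)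

  block : ℕ → List ℕ → List ℕ
  block k Y = concatMap (λ S → map (insertAll S) Y) (combs k Bm)

  block-length : ∀ k Y → length (block k Y) ≡ (length Bm C k) * length Y
  block-length k Y = trans (length-pairs insertAll (combs k Bm) Y) (cong (_* length Y) (combs-count k Bm))

  block-intro : ∀ k {S y Y} → S ∈ combs k Bm → y ∈ Y → insertAll S y ∈ block k Y
  block-intro k {S} S∈ y∈ = ∈-concatMap⁺ _ (lose S∈ (∈-map⁺ (insertAll S) y∈))

  block-elim : ∀ {k Y x} → x ∈ block k Y → Σ (List ℕ) λ S → Σ ℕ λ y → S ∈ combs k Bm × y ∈ Y × x ≡ insertAll S y
  block-elim {k} {Y} p with find (∈-concatMap⁻ (λ S → map (insertAll S) Y) {xs = combs k Bm} p)
  ... | S , S∈ , q with ∈-map⁻ (insertAll S) q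
  ...   | y , y∈ , eq = S , y , S∈ , y∈ , eq

  block-! : ∀ k {Y} → Unique Y → (∀ y → y ∈ Y → Small m y) → Unique (block k Y)
  block-! k {Y} uY Y-small = unique-concatMap (λ S → map (insertAll S) Y) (combs-! k Bm Bm-!)
    (λ {S} S∈ → unique-map (insertAll S) uY (λ p q e → proj₂ (insertAll-injective k k S∈ S∈ (Y-small _ p) (Y-small _ q) e)))
    (λ S∈ S'∈ p q → let (y , y∈ , e) = ∈-map⁻ _ p ; (y' , y'∈ , e') = ∈-map⁻ _ q in
       proj₁ (insertAll-injective k k S∈ S'∈ (Y-small y y∈) (Y-small y' y'∈) (trans (sym e) e')))

  κ-block : ∀ k {Y x} → (∀ y → y ∈ Y → Small m y) → x ∈ block k Y → κ x ≡ k
  κ-block k Y-small p with block-elim {k} p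
  ... | S , y , S∈ , y∈ , refl = κ-insertAll S∈ (Y-small y y∈)

  insertAll-below : ∀ k {S y} → S ∈ combs k Bm → Small m y → Small (suc m) (insertAll S y)
  insertAll-below k {S} {y} S∈ y-small i p =
    [ (λ q → proj₁ (chosen-fresh k S∈ i q)) , (λ q → ALt⊆A m (y-small i q)) ]′ (to (insertAll-∈ S y i) p)

  chosen-∈A⇔ : ∀ k {S y} n → S ∈ combs (suc k) Bm → Small m y
             → insertAll S y ∈ Aℕ n ⇔ (suc k + m ≤ n × y ∈ Aℕ (n ∸ suc k))
  chosen-∈A⇔ k {S} {y} n S∈ y-small =
    subst (λ l → insertAll S y ∈ Aℕ n ⇔ (l + m ≤ n × y ∈ Aℕ (n ∸ l))) (combs-length (suc k) Bm S∈)
      (insertAll-∈A⇔ n S y (chosen-! (suc k) S∈) nonempty (chosen-fresh (suc k) S∈) y-small)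
    where
    nonempty : S ≢ []
    nonempty refl = case combs-length (suc k) Bm S∈ of λ ()

  chosen-fresh-below : ∀ k {S y} n → S ∈ combs (suc k) Bm → Small m y → suc k + m < n
                     → Fresh n (insertAll S y) ⇔ Fresh (n ∸ suc k) y
  chosen-fresh-below k {S} {y} (suc n) S∈ y-small (s≤s bound) = mk⇔
    (λ (x∈ , x∉) → proj₂ (to (level-of (suc n)) x∈) ,
                    λ y∈ → x∉ (from (level-of n) (bound , subst (y ∈_) one-below y∈)))
    (λ (y∈ , y∉) → from (level-of (suc n)) (m≤n⇒m≤1+n bound , y∈) ,
                    λ x∈ → y∉ (subst (y ∈_) (sym one-below) (proj₂ (to (level-of n) x∈))))
    where
    level-of : ∀ n → insertAll S y ∈ Aℕ n ⇔ (suc k + m ≤ n × y ∈ Aℕ (n ∸ suc k))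
    level-of n = chosen-∈A⇔ k n S∈ y-small
    one-below : ALt (n ∸ k) ≡ Aℕ (n ∸ suc k)
    one-below = cong ALt (+-∸-assoc 1 (m+n≤o⇒m≤o (suc k) bound))

  chosen-fresh-top : ∀ k {S y} n → S ∈ combs (suc k) Bm → Small m y → suc k + m ≡ n
                   → Fresh n (insertAll S y) ⇔ y ∈ Aℕ m
  chosen-fresh-top k {S} {y} _ S∈ y-small refl = mk⇔
    (λ (x∈ , _) → subst (λ l → y ∈ Aℕ l) (m+n∸m≡n k m) (proj₂ (to (level-of (suc k + m)) x∈)))
    (λ y∈ → from (level-of (suc k + m)) (≤-refl , subst (λ l → y ∈ Aℕ l) (sym (m+n∸m≡n k m)) y∈) ,
            λ x∈ → <-irrefl refl (proj₁ (to (level-of (k + m)) x∈)))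
    where
    level-of : ∀ n → insertAll S y ∈ Aℕ n ⇔ (suc k + m ≤ n × y ∈ Aℕ (n ∸ suc k))
    level-of n = chosen-∈A⇔ k n S∈ y-small

module Recursion (n m t : ℕ) (m<n : m < n) where
  open Split m

  m≤n : m ≤ n
  m≤n = <⇒≤ m<n

  Dk : ℕ → List ℕ
  Dk k = D (+ t -ℤ + k) (+ n -ℤ + k) (+ m -ℤ + 1)

  top-bound : ℤ
  top-bound = (+ t -ℤ + n) +ℤ + m

  lowLevels : List ℕ
  lowLevels = concatMap (λ j → D top-bound (+ j) (+ j -ℤ + 1)) (upTo (suc m))

  noneFresh someFresh topFresh RHS : List ℕ
  noneFresh = D (+ t) (+ n) (+ m -ℤ + 1)
  someFresh = concatMap (λ i → block (suc i) (Dk (suc i))) (upTo (n ∸ m ∸ 1))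
  topFresh = block (n ∸ m) lowLevels
  RHS = (noneFresh ++ someFresh) ++ topFresh

  RHS-length : length RHS
             ≡ d (+ t) (+ n) (+ m -ℤ + 1)
               + sumFromTo 1 (n ∸ m ∸ 1)
                   (λ k → d (+ t -ℤ + k) (+ n -ℤ + k) (+ m -ℤ + 1) * (b (+ m) (+ m -ℤ + 1) C k))
               + (b (+ m) (+ m -ℤ + 1) C (n ∸ m))
                   * sumFromTo 0 m (λ k → d top-bound (+ k) (+ k -ℤ + 1))
  RHS-length = trans (length-++ (noneFresh ++ someFresh))
    (cong₂ _+_ (trans (length-++ noneFresh) (cong (λ r → length noneFresh + r) someFresh-length)) topFresh-length)
    where
    someFresh-length : length someFresh
      ≡ sumFromTo 1 (n ∸ m ∸ 1) (λ k → d (+ t -ℤ + k) (+ n -ℤ + k) (+ m -ℤ + 1) * (b (+ m) (+ m -ℤ + 1) C k))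
    someFresh-length = trans (length-concatMap (λ i → block (suc i) (Dk (suc i))) (upTo (n ∸ m ∸ 1)))
      (cong sum (map-cong (λ i → trans (block-length (suc i) (Dk (suc i))) (*-comm (length Bm C suc i) _))
                          (upTo (n ∸ m ∸ 1))))
    topFresh-length : length topFresh
      ≡ (b (+ m) (+ m -ℤ + 1) C (n ∸ m)) * sumFromTo 0 m (λ k → d top-bound (+ k) (+ k -ℤ + 1))
    topFresh-length = trans (block-length (n ∸ m) lowLevels)
      (cong ((length Bm C (n ∸ m)) *_) (length-concatMap (λ j → D top-bound (+ j) (+ j -ℤ + 1)) (upTo (suc m))))

  Dk-mem : ∀ k → k ≤ n → ∀ y → y ∈ Dk k ⇔ InD (+ t -ℤ + k) (n ∸ k) m y
  Dk-mem k k≤n y rewrite sub-nonneg n k k≤n = D-mem (+ t -ℤ + k) (n ∸ k) m y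

  lowLevels-intro : ∀ {j y} → j ≤ m → InD top-bound j j y → y ∈ lowLevels
  lowLevels-intro {j} {y} j≤m d =
    ∈-concatMap⁺ (λ j → D top-bound (+ j) (+ j -ℤ + 1)) (lose (∈-upTo⁺ (s≤s j≤m)) (from (D-mem top-bound j j y) d))

  lowLevels-elim : ∀ {y} → y ∈ lowLevels → Σ ℕ λ j → j ≤ m × InD top-bound j j y
  lowLevels-elim {y} p with find (∈-concatMap⁻ (λ j → D top-bound (+ j) (+ j -ℤ + 1)) {xs = upTo (suc m)} p)
  ... | j , j∈ , q = j , ≤-pred (∈-upTo⁻ j∈) , to (D-mem top-bound j j y) q

  lowLevels-small : ∀ y → y ∈ lowLevels → Small m y
  lowLevels-small y p i q = let (j , j≤m , d) = lowLevels-elim p in ALt-mono j≤m (small d i q)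

  Dk-small : ∀ k y → y ∈ Dk k → Small m y
  Dk-small k y = D-small (+ t -ℤ + k) (+ n -ℤ + k) m

  someFresh-index⇔ : ∀ i → i < n ∸ m ∸ 1 ⇔ suc i + m < n
  someFresh-index⇔ i = mk⇔
    (λ p → subst (λ k → k + m < n) (+-comm i 1) (to (<∸⇔ (i + 1) m≤n) (to (<∸⇔ i (m<n⇒0<n∸m m<n)) p)))
    (λ p → from (<∸⇔ i (m<n⇒0<n∸m m<n)) (from (<∸⇔ (i + 1) m≤n) (subst (λ k → k + m < n) (+-comm 1 i) p)))

  size-shift : ∀ k {S y} → S ∈ combs k Bm → Small m y
             → + card y ≤ℤ + t -ℤ + k → + card (insertAll S y) ≤ℤ + t
  size-shift k {S} {y} S∈ y-small p =
    +≤+ (subst (_≤ t) (trans (+-comm (card y) k) (sym (card-insertAll S∈ y-small))) (to (≤-sub⇔ (card y) t k) p))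

  size-unshift : ∀ k {S y} → S ∈ combs k Bm → Small m y
               → + card (insertAll S y) ≤ℤ + t → + card y ≤ℤ + t -ℤ + k
  size-unshift k {S} {y} S∈ y-small p =
    from (≤-sub⇔ (card y) t k) (subst (_≤ t) (trans (card-insertAll S∈ y-small) (+-comm k (card y))) (ℤ.drop‿+≤+ p))

  k₀ : ℕ
  k₀ = n ∸ suc m

  gap≡ : n ∸ m ≡ suc k₀
  gap≡ = +-∸-assoc 1 m<n

  top≡ : suc k₀ + m ≡ n
  top≡ = trans (cong (_+ m) (sym gap≡)) (m∸n+n≡m m≤n)

  noneFresh⊆ : ∀ x → x ∈ noneFresh → InD (+ t) n (suc m) x
  noneFresh⊆ x p = let d = to (D-mem (+ t) n m x) p in
    mkInD (fresh d) (λ i q → ALt⊆A m (small d i q)) (size d)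

  someFresh⊆ : ∀ x → x ∈ someFresh → InD (+ t) n (suc m) x
  someFresh⊆ x p with find (∈-concatMap⁻ (λ i → block (suc i) (Dk (suc i))) {xs = upTo (n ∸ m ∸ 1)} p)
  ... | i , i∈ , q with block-elim {suc i} q
  ...   | S , y , S∈ , y∈ , refl =
    mkInD (from (chosen-fresh-below i n S∈ (small dy) bound) (fresh dy))
          (insertAll-below (suc i) S∈ (small dy))
          (size-shift (suc i) S∈ (small dy) (size dy))
    where
    bound : suc i + m < n
    bound = to (someFresh-index⇔ i) (∈-upTo⁻ i∈)
    dy : InD (+ t -ℤ + suc i) (n ∸ suc i) m y
    dy = to (Dk-mem (suc i) (m+n≤o⇒m≤o (suc i) (<⇒≤ bound)) y) y∈

  topFresh⊆ : ∀ x → x ∈ topFresh → InD (+ t) n (suc m) x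
  topFresh⊆ x p with block-elim {n ∸ m} p
  ... | S , y , S∈ , y∈ , refl with lowLevels-elim y∈
  ...   | j , j≤m , dy =
    mkInD (from (chosen-fresh-top k₀ n (subst (λ l → S ∈ combs l Bm) gap≡ S∈) y-small top≡) (A-mono j≤m (proj₁ (fresh dy))))
          (insertAll-below (n ∸ m) S∈ y-small)
          (size-shift (n ∸ m) S∈ y-small (subst (+ card y ≤ℤ_) (last-bound≡ t n m m≤n) (size dy)))
    where
    y-small : Small m y
    y-small = lowLevels-small y y∈

  classify : ∀ k {S y} → S ∈ combs k Bm → Small m y → InD (+ t) n (suc m) (insertAll S y) → insertAll S y ∈ RHS
  classify zero {y = y} (here refl) y-small d =
    ∈-++⁺ˡ (∈-++⁺ˡ (from (D-mem (+ t) n m y) (mkInD (fresh d) y-small (size d))))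
  classify (suc k) {S} {y} S∈ y-small d
    with m≤n⇒m<n∨m≡n (proj₁ (to (chosen-∈A⇔ k n S∈ y-small) (proj₁ (fresh d))))
  ... | inj₁ below =
    ∈-++⁺ˡ (∈-++⁺ʳ noneFresh (∈-concatMap⁺ (λ i → block (suc i) (Dk (suc i)))
                                (lose (∈-upTo⁺ (from (someFresh-index⇔ k) below)) (block-intro (suc k) S∈ y∈))))
    where
    y∈ : y ∈ Dk (suc k)
    y∈ = from (Dk-mem (suc k) (m+n≤o⇒m≤o (suc k) (<⇒≤ below)) y)
              (mkInD (to (chosen-fresh-below k n S∈ y-small below) (fresh d)) y-small
                     (size-unshift (suc k) S∈ y-small (size d)))
  ... | inj₂ top = ∈-++⁺ʳ (noneFresh ++ someFresh) (block-intro (n ∸ m) (subst (λ l → S ∈ combs l Bm) k≡ S∈) y∈)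
    where
    k≡ : suc k ≡ n ∸ m
    k≡ = trans (sym (m+n∸n≡m (suc k) m)) (cong (_∸ m) top)
    y∈Am : y ∈ Aℕ m
    y∈Am = to (chosen-fresh-top k n S∈ y-small top) (fresh d)
    y∈ : y ∈ lowLevels
    y∈ with level m y∈Am
    ... | j , j≤m , y-fresh = lowLevels-intro j≤m (mkInD y-fresh (λ i q → A-elem j (proj₁ y-fresh) q)
      (subst (+ card y ≤ℤ_) (sym (last-bound≡ t n m m≤n))
        (subst (λ l → + card y ≤ℤ + t -ℤ + l) k≡ (size-unshift (suc k) S∈ y-small (size d)))))

  fwd : ∀ x → InD (+ t) n (suc m) x → x ∈ RHS
  fwd x d = subst (_∈ RHS) (sym x≡)
    (classify (κ x) (freshPart-chosen x) (smallPart-small x) (subst (InD (+ t) n (suc m)) x≡ d))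
    where
    x≡ : x ≡ insertAll (freshPart x) (smallPart x)
    x≡ = split x (small d)

  bwd : ∀ x → x ∈ RHS → InD (+ t) n (suc m) x
  bwd x p = [ (λ q → [ noneFresh⊆ x , someFresh⊆ x ]′ (∈-++⁻ noneFresh q)) , topFresh⊆ x ]′
              (∈-++⁻ (noneFresh ++ someFresh) p)

  -- the right-hand side has no repetitions; κ separates the three summands
  lowLevels-! : Unique lowLevels
  lowLevels-! = unique-concatMap (λ j → D top-bound (+ j) (+ j -ℤ + 1)) (upTo⁺ (suc m))
    (λ {j} _ → D-! top-bound (+ j) (+ j -ℤ + 1))
    (λ {j} {j'} {y} _ _ p q → level-unique (fresh (to (D-mem top-bound j j y) p)) (fresh (to (D-mem top-bound j' j' y) q)))

  κ-noneFresh : ∀ {x} → x ∈ noneFresh → κ x ≡ 0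
  κ-noneFresh p = κ-insertAll {0} (here refl) (D-small (+ t) (+ n) m p)

  κ-someFresh : ∀ {x} → x ∈ someFresh → Σ ℕ λ i → suc i + m < n × κ x ≡ suc i
  κ-someFresh p with find (∈-concatMap⁻ (λ i → block (suc i) (Dk (suc i))) {xs = upTo (n ∸ m ∸ 1)} p)
  ... | i , i∈ , q = i , to (someFresh-index⇔ i) (∈-upTo⁻ i∈) , κ-block (suc i) (Dk-small (suc i)) q

  κ-topFresh : ∀ {x} → x ∈ topFresh → κ x ≡ n ∸ m
  κ-topFresh = κ-block (n ∸ m) lowLevels-small

  RHS-! : Unique RHS
  RHS-! = ++⁺ (++⁺ (D-! (+ t) (+ n) (+ m -ℤ + 1)) someFresh-! none∩some) (block-! (n ∸ m) lowLevels-! lowLevels-small) low∩top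
    where
    someFresh-! : Unique someFresh
    someFresh-! = unique-concatMap (λ i → block (suc i) (Dk (suc i))) (upTo⁺ (n ∸ m ∸ 1))
      (λ {i} _ → block-! (suc i) (D-! (+ t -ℤ + suc i) (+ n -ℤ + suc i) (+ m -ℤ + 1)) (Dk-small (suc i)))
      (λ {i} {i'} _ _ p q → suc-injective (trans (sym (κ-block (suc i) (Dk-small (suc i)) p)) (κ-block (suc i') (Dk-small (suc i')) q)))
    none∩some : ∀ {x} → x ∈ noneFresh × x ∈ someFresh → ⊥
    none∩some (p , q) = let (i , _ , κ≡) = κ-someFresh q in 0≢1+n (trans (sym (κ-noneFresh p)) κ≡)
    low∩top : ∀ {x} → x ∈ noneFresh ++ someFresh × x ∈ topFresh → ⊥
    low∩top {x} (p , q) with ∈-++⁻ noneFresh p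
    ... | inj₁ p₀ = <-irrefl (trans (sym (κ-noneFresh p₀)) (κ-topFresh q)) (m<n⇒0<n∸m m<n)
    ... | inj₂ p₁ = let (i , bound , κ≡) = κ-someFresh p₁ in
      <-irrefl (trans (sym κ≡) (κ-topFresh q)) (from (<∸⇔ (suc i) m≤n) bound)

  recursion : d (+ t) (+ n) (+ m) ≡ length RHS
  recursion = count (D-! (+ t) (+ n) (+ m)) RHS-!
    (λ x p → fwd x (to (D-mem (+ t) n (suc m) x) p)) (λ x p → from (D-mem (+ t) n (suc m) x) (bwd x p))

theorem4 : (n m t : ℕ) → m < n → t ≤ n →
    d (+ t) (+ n) (+ m)
      ≡ d (+ t) (+ n) (+ m -ℤ + 1)
        + sumFromTo 1 (n ∸ m ∸ 1)
            (λ k → d (+ t -ℤ + k) (+ n -ℤ + k) (+ m -ℤ + 1) * (b (+ m) (+ m -ℤ + 1) C k))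
        + (b (+ m) (+ m -ℤ + 1) C (n ∸ m))
            * sumFromTo 0 m (λ k → d ((+ t -ℤ + n) +ℤ + m) (+ k) (+ k -ℤ + 1))
theorem4 n m t m<n _ = begin
    d (+ t) (+ n) (+ m)  ≡⟨ recursion ⟩
    length RHS           ≡⟨ RHS-length ⟩
    _                    ∎
  where
  open ≡-Reasoning
  open Recursion n m t m<n
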